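{- For every integer $n\geq 4$ there exist connected graphs $G$ and $H$, each on $n$ vertices, such that $\psi(G)=\psi(H)$ but $G$ and $H$ are not isomorphic.
   Context: All graphs are finite and simple. For a graph $G=(V,E)$ and a positive integer $k$, a $k$-path vertex cover of $G$ is a set $S\subseteq V$ such that every path on $k$ vertices in $G$ contains at least one vertex of $S$, and $\psi_k(G)$ is the minimum cardinality of such a set. For a graph $G$ on $n$ vertices, its path sequence is $\psi(G)=(\psi_1(G),\psi_2(G),\ldots,\psi_n(G))$. -}

module Defs where

open import Data.Nat using (ℕ; suc; _≤_)
import Data.Fin
open import Data.Fin using (Fin; zero; suc)
open import Data.Fin.Subset using (Subset; _∈_; ∣_∣)
open import Data.Bool using (Bool; true; false)
open import Data.Product using (Σ; ∃; _×_; _,_)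
open import Function.Definitions using (Injective)
open import Function.Bundles using (_↔_; Inverse)
open import Relation.Binary.PropositionalEquality using (_≡_)
open import Relation.Binary.Construct.Closure.ReflexiveTransitive using (Star)
open import Relation.Nullary using (¬_)

record Graph (n : ℕ) : Set where
  field
    adj   : Fin n → Fin n → Bool
    sym   : ∀ u v → adj u v ≡ adj v u
    irefl : ∀ v → adj v v ≡ false
open Graph public

Adj : ∀ {n} → Graph n → Fin n → Fin n → Set
Adj G u v = adj G u v ≡ true

record Path {n : ℕ} (G : Graph n) (k : ℕ) : Set where
  field
    vtx  : Fin k → Fin n
    inj  : Injective _≡_ _≡_ vtx
    step : ∀ (i : Fin k) (j : Fin k) → Data.Fin.toℕ j ≡ suc (Data.Fin.toℕ i) → Adj G (vtx i) (vtx j)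
open Path public

IsKPathVertexCover : ∀ {n} → Graph n → ℕ → Subset n → Set
IsKPathVertexCover G k S = (P : Path G k) → ∃ λ (i : Fin k) → vtx P i ∈ S

IsPsi : ∀ {n} → Graph n → ℕ → ℕ → Set
IsPsi G k m =
  (∃ λ S → IsKPathVertexCover G k S × ∣ S ∣ ≡ m)
  × (∀ S → IsKPathVertexCover G k S → m ≤ ∣ S ∣)

SamePathSequence : ∀ {n} → Graph n → Graph n → Set
SamePathSequence {n} G H =
  ∃ λ (ψ : Fin n → ℕ) → ∀ (i : Fin n) →
    IsPsi G (suc (Data.Fin.toℕ i)) (ψ i) × IsPsi H (suc (Data.Fin.toℕ i)) (ψ i)

Connected : ∀ {n} → Graph n → Set
Connected {n} G = ∀ (u v : Fin n) → Star (Adj G) u v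

Isomorphic : ∀ {n} → Graph n → Graph n → Set
Isomorphic {n} G H =
  Σ (Fin n ↔ Fin n) λ f → ∀ u v → adj G u v ≡ adj H (Inverse.to f u) (Inverse.to f v)

module Submission where

-- Call a graph nearly complete if every vertex has at most one non-neighbour,
-- i.e. its complement is a matching.  In such a graph any three or more distinct
-- vertices can be ordered into a path (insert them one at a time: a new vertex
-- goes in front of the path, or, if it misses the first vertex, right after the
-- second one).  Hence, if vertices 0 and 1 are non-adjacent, the path sequence
-- is forced:  ψ₁ = n,  ψ₂ = n - 2,  ψ_k = n - k + 1 for k ≥ 3;  the upper bounds
-- come from the covers {v : v ≥ t} (pigeonhole), the lower bounds from the fact
-- that t + 1 ≥ 3 vertices outside a cover would form an uncovered path.
-- Such a graph on n ≥ 3 vertices also has diameter at most two.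
--
-- The family K_n minus the edges {0,1},{2,3},…,{2m-2,2m-1} is nearly complete;
-- for m = 1 and m = 2 we get the two graphs.  They are not isomorphic because
-- an isomorphism preserves the vertices having a non-neighbour, which are the
-- 2m vertices below 2m, and by pigeonhole 2m + 1 of them for the larger m cannot
-- be mapped injectively onto those for the smaller m.

open import Defs hiding (sym)
open import Data.Bool using (Bool; true; false; not; _∧_)
open import Data.Bool.Properties using (not-injective) renaming (_≟_ to _≟ᵇ_)
open import Data.Empty using (⊥-elim)
open import Data.Fin using (Fin; zero; suc; toℕ; fromℕ<; inject≤)
open import Data.Fin.Properties
  using (_≟_; suc-injective; toℕ<n; toℕ-injective; toℕ-fromℕ<; toℕ-inject≤; inject≤-injective;
         pigeonhole; any?; <-irrefl)
open import Data.Fin.Subset using (Subset; _∈_; _∉_; ∣_∣; inside; outside; ⊤)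
open import Data.Fin.Subset.Properties using (drop-there; ∣⊤∣≡n; p⊆q⇒∣p∣≤∣q∣)
open import Data.Vec.Base using ([]; _∷_; here; there)
open import Data.List.Base using (List; []; _∷_; length; lookup; map; take)
open import Data.List.Properties using (length-map; length-take)
open import Data.List.Membership.Propositional.Properties using (∈-lookup)
open import Data.List.Relation.Unary.All as All using (All; []; _∷_)
import Data.List.Relation.Unary.All.Properties as All
open import Data.List.Relation.Unary.Linked using (Linked; []; [-]; _∷_)
import Data.List.Relation.Unary.Linked as Linked
open import Data.List.Relation.Unary.AllPairs using ([]; _∷_)
open import Data.List.Relation.Unary.Unique.Propositional using (Unique)
import Data.List.Relation.Unary.Unique.Propositional.Properties as Unique
open import Data.List.Relation.Binary.Permutation.Propositional
  using (_↭_; ↭-refl; ↭-prep; ↭-swap; ↭-trans; ↭-sym; ↭⇒↭ₛ)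
open import Data.List.Relation.Binary.Permutation.Propositional.Properties
  using (All-resp-↭; ↭-length; shift)
import Data.List.Relation.Binary.Permutation.Setoid.Properties as SetoidPermutation
open import Data.Nat using (ℕ; zero; suc; _+_; _*_; _∸_; _≤_; _<_; z≤n; s≤s; _≤?_)
open import Data.Nat.Properties
  using (≤-refl; ≤-trans; ≤-reflexive; ≰⇒>; n<1+n; n≤1+n; <-≤-trans; m≤n⇒m⊓n≡m; +-cancelʳ-≤;
         m≤n+o⇒m∸n≤o; +-suc; *-suc; *-monoʳ-<)
  renaming (suc-injective to ℕ-suc-injective)
open import Data.Product using (Σ; ∃; ∃₂; _×_; _,_; proj₁; proj₂)
open import Data.Sum using (_⊎_; inj₁; inj₂)
open import Function.Base using (_∘_)
open import Function.Bundles using (_↔_; Inverse; Injection)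
open import Function.Properties.Inverse using (↔-sym; ↔⇒↣)
open import Function.Definitions using (Injective)
open import Relation.Binary.Construct.Closure.ReflexiveTransitive using (ε; _◅_)
open import Relation.Binary.PropositionalEquality
  using (_≡_; _≢_; refl; sym; trans; cong; cong₂; subst; setoid; ≢-sym; module ≡-Reasoning)
open import Relation.Nullary using (¬_; Dec; yes; no; does; contradiction)
open import Relation.Nullary.Decidable using (dec-true; dec-false)

unique-↭ : ∀ {A : Set} {xs ys : List A} → xs ↭ ys → Unique xs → Unique ys
unique-↭ {A} p = SetoidPermutation.Unique-resp-↭ (setoid A) (↭⇒↭ₛ p)

lookup-injective : ∀ {A : Set} {xs : List A} → Unique xs →
                   ∀ {i j} → lookup xs i ≡ lookup xs j → i ≡ j
lookup-injective (_ ∷ _) {zero} {zero} _ = refl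
lookup-injective (x≢xs ∷ _) {zero} {suc j} e = contradiction e (All.lookup x≢xs (∈-lookup j))
lookup-injective (x≢xs ∷ _) {suc i} {zero} e = contradiction (sym e) (All.lookup x≢xs (∈-lookup i))
lookup-injective (_ ∷ u) {suc i} {suc j} e = cong suc (lookup-injective u e)

noInjectionBelow : ∀ {k t n} (f : Fin k → Fin n) → Injective _≡_ _≡_ f → t < k →
                   ¬ (∀ i → toℕ (f i) < t)
noInjectionBelow f f-inj t<k below with pigeonhole t<k (λ i → fromℕ< (below i))
... | i , j , i<j , same = <-irrefl (f-inj (toℕ-injective toℕ-same)) i<j
  where
    open ≡-Reasoning
    toℕ-same : toℕ (f i) ≡ toℕ (f j)
    toℕ-same = begin
      toℕ (f i)                ≡⟨ sym (toℕ-fromℕ< (below i)) ⟩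
      toℕ (fromℕ< (below i))   ≡⟨ cong toℕ same ⟩
      toℕ (fromℕ< (below j))   ≡⟨ toℕ-fromℕ< (below j) ⟩
      toℕ (f j)                ∎

atLeast : (n t : ℕ) → Subset n
atLeast zero t = []
atLeast (suc n) zero = inside ∷ atLeast n zero
atLeast (suc n) (suc t) = outside ∷ atLeast n t

∣atLeast∣ : ∀ n t → ∣ atLeast n t ∣ ≡ n ∸ t
∣atLeast∣ zero zero = refl
∣atLeast∣ zero (suc t) = refl
∣atLeast∣ (suc n) zero = cong suc (∣atLeast∣ n zero)
∣atLeast∣ (suc n) (suc t) = ∣atLeast∣ n t

∈atLeast : ∀ {n} t (v : Fin n) → t ≤ toℕ v → v ∈ atLeast n t
∈atLeast zero zero _ = here
∈atLeast zero (suc v) _ = there (∈atLeast zero v z≤n)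
∈atLeast (suc t) (suc v) (s≤s t≤v) = there (∈atLeast t v t≤v)

outsideOf : ∀ {n} → Subset n → List (Fin n)
outsideOf [] = []
outsideOf (inside ∷ s) = map suc (outsideOf s)
outsideOf (outside ∷ s) = zero ∷ map suc (outsideOf s)

outsideOf-unique : ∀ {n} (s : Subset n) → Unique (outsideOf s)
outsideOf-unique [] = []
outsideOf-unique (inside ∷ s) = Unique.map⁺ suc-injective (outsideOf-unique s)
outsideOf-unique (outside ∷ s) =
  All.map⁺ (All.universal (λ _ ()) (outsideOf s)) ∷ Unique.map⁺ suc-injective (outsideOf-unique s)

outsideOf-∉ : ∀ {n} (s : Subset n) → All (_∉ s) (outsideOf s)
outsideOf-∉ [] = []
outsideOf-∉ (inside ∷ s) = All.map⁺ (All.map (_∘ drop-there) (outsideOf-∉ s))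
outsideOf-∉ (outside ∷ s) = (λ ()) ∷ All.map⁺ (All.map (_∘ drop-there) (outsideOf-∉ s))

length-outsideOf : ∀ {n} (s : Subset n) → length (outsideOf s) + ∣ s ∣ ≡ n
length-outsideOf [] = refl
length-outsideOf {suc n} (inside ∷ s) = begin
  length (map suc (outsideOf s)) + suc ∣ s ∣  ≡⟨ cong (_+ suc ∣ s ∣) (length-map suc (outsideOf s)) ⟩
  length (outsideOf s) + suc ∣ s ∣            ≡⟨ +-suc (length (outsideOf s)) ∣ s ∣ ⟩
  suc (length (outsideOf s) + ∣ s ∣)          ≡⟨ cong suc (length-outsideOf s) ⟩
  suc n                                       ∎
  where open ≡-Reasoning
length-outsideOf (outside ∷ s) =
  cong suc (trans (cong (_+ ∣ s ∣) (length-map suc (outsideOf s))) (length-outsideOf s))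

distinctOutside : ∀ {n} (S : Subset n) k → k + ∣ S ∣ ≤ n →
                  ∃ λ xs → Unique xs × All (_∉ S) xs × length xs ≡ k
distinctOutside S k bound =
  take k (outsideOf S) , Unique.take⁺ k (outsideOf-unique S) , All.take⁺ k (outsideOf-∉ S) ,
  trans (length-take k (outsideOf S)) (m≤n⇒m⊓n≡m k≤outside)
  where
    k≤outside : k ≤ length (outsideOf S)
    k≤outside = +-cancelʳ-≤ ∣ S ∣ k (length (outsideOf S))
                  (subst (k + ∣ S ∣ ≤_) (sym (length-outsideOf S)) bound)

module _ {n : ℕ} (G : Graph n) where

  adj-sym : ∀ {u v} → Adj G u v → Adj G v u
  adj-sym {u} {v} uv = trans (Graph.sym G v u) uv

  adjacent? : ∀ u v → Dec (Adj G u v)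
  adjacent? u v = adj G u v ≟ᵇ true

  linked-step : ∀ {xs} → Linked (Adj G) xs → ∀ (i j : Fin (length xs)) →
                toℕ j ≡ suc (toℕ i) → Adj G (lookup xs i) (lookup xs j)
  linked-step [-] zero zero ()
  linked-step (uv ∷ _) zero (suc zero) _ = uv
  linked-step (_ ∷ _) zero zero ()
  linked-step (_ ∷ _) zero (suc (suc _)) ()
  linked-step (_ ∷ _) (suc _) zero ()
  linked-step (_ ∷ linked) (suc i) (suc j) e = linked-step linked i j (ℕ-suc-injective e)

  listPath : ∀ xs → Unique xs → Linked (Adj G) xs → Path G (length xs)
  listPath xs unique linked = record
    { vtx = lookup xs ; inj = lookup-injective unique ; step = linked-step linked }

  prefixPath : ∀ {j k} → Path G k → j ≤ k → Path G j
  prefixPath P j≤k = record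
    { vtx = λ i → vtx P (inject≤ i j≤k)
    ; inj = λ e → inject≤-injective j≤k j≤k _ _ (inj P e)
    ; step = λ i j e →
        step P _ _ (trans (toℕ-inject≤ j j≤k) (trans e (cong suc (sym (toℕ-inject≤ i j≤k)))))
    }

  singlePath : Fin n → Path G 1
  singlePath v = record
    { vtx = λ _ → v ; inj = λ { {zero} {zero} _ → refl } ; step = λ { zero zero () } }

  everyVertexCover : ∀ S → IsKPathVertexCover G 1 S → n ≤ ∣ S ∣
  everyVertexCover S cover =
    subst (_≤ ∣ S ∣) (∣⊤∣≡n n) (p⊆q⇒∣p∣≤∣q∣ {p = ⊤} λ {v} _ → proj₂ (cover (singlePath v)))

  -- The vertices with index ≥ t meet every path on more than t vertices, since
  -- such a path cannot fit injectively into the t vertices below t.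
  atLeast-cover : ∀ {t k} → t < k → IsKPathVertexCover G k (atLeast n t)
  atLeast-cover {t} t<k P with any? (λ i → t ≤? toℕ (vtx P i))
  ... | yes (i , t≤v) = i , ∈atLeast t (vtx P i) t≤v
  ... | no none =
    ⊥-elim (noInjectionBelow (vtx P) (inj P) t<k (λ i → ≰⇒> (λ t≤v → none (i , t≤v))))

  FirstPairIndependent : Set
  FirstPairIndependent = ∀ u v → toℕ u < 2 → toℕ v < 2 → ¬ Adj G u v

  firstPair-cover : FirstPairIndependent → IsKPathVertexCover G 2 (atLeast n 2)
  firstPair-cover independent P with 2 ≤? toℕ (vtx P zero) | 2 ≤? toℕ (vtx P (suc zero))
  ... | yes 2≤u | _ = zero , ∈atLeast 2 _ 2≤u
  ... | no _ | yes 2≤v = suc zero , ∈atLeast 2 _ 2≤v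
  ... | no 2≰u | no 2≰v =
    ⊥-elim (independent _ _ (≰⇒> 2≰u) (≰⇒> 2≰v) (step P zero (suc zero) refl))

-- Every vertex has at most one non-neighbour: of any two other vertices it is
-- adjacent to at least one.  Equivalently, the complement is a matching.
NearlyComplete : ∀ {n} → Graph n → Set
NearlyComplete G = ∀ {u v w} → u ≢ v → u ≢ w → v ≢ w → Adj G u v ⊎ Adj G u w

thirdVertex : ∀ {n} → 3 ≤ n → (u v : Fin n) → ∃ λ w → u ≢ w × v ≢ w
thirdVertex (s≤s (s≤s (s≤s _))) zero zero = suc zero , (λ ()) , (λ ())
thirdVertex (s≤s (s≤s (s≤s _))) zero (suc zero) = suc (suc zero) , (λ ()) , (λ ())
thirdVertex (s≤s (s≤s (s≤s _))) zero (suc (suc _)) = suc zero , (λ ()) , (λ ())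
thirdVertex (s≤s (s≤s (s≤s _))) (suc zero) zero = suc (suc zero) , (λ ()) , (λ ())
thirdVertex (s≤s (s≤s (s≤s _))) (suc (suc _)) zero = suc zero , (λ ()) , (λ ())
thirdVertex (s≤s (s≤s (s≤s _))) (suc _) (suc _) = zero , (λ ()) , (λ ())

-- The value of ψ_{i+1} for a nearly complete graph in which 0 and 1 are
-- non-adjacent is n - t(i), where t(i) = 0, 2, i for i = 0, i = 1, i ≥ 2.
coverThreshold : ∀ {n} → Fin n → ℕ
coverThreshold zero = 0
coverThreshold (suc zero) = 2
coverThreshold i@(suc (suc _)) = toℕ i

module NearlyCompleteGraph {n : ℕ} {G : Graph n} (nearly : NearlyComplete G) where

  otherNeighbour : ∀ {u v w} → ¬ Adj G u v → u ≢ v → u ≢ w → v ≢ w → Adj G u w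
  otherNeighbour ¬uv u≢v u≢w v≢w with nearly u≢v u≢w v≢w
  ... | inj₁ uv = contradiction uv ¬uv
  ... | inj₂ uw = uw

  -- A vertex x new to a path of at least two vertices can be inserted into it:
  -- in front of the first vertex h if adjacent to h, and otherwise right after
  -- the second vertex, x being adjacent to everything but h.
  insert : ∀ {x ys} → Unique ys → All (x ≢_) ys → Linked (Adj G) ys → 2 ≤ length ys →
           ∃ λ zs → zs ↭ x ∷ ys × Linked (Adj G) zs
  insert {x} {h ∷ h₂ ∷ rest} ((h≢h₂ ∷ h≢rest) ∷ _) (x≢h ∷ x≢h₂ ∷ x≢rest) (hh₂ ∷ linked) _
    with adjacent? G x h
  ... | yes xh = x ∷ h ∷ h₂ ∷ rest , ↭-refl , xh ∷ hh₂ ∷ linked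
  ... | no ¬xh = h ∷ h₂ ∷ x ∷ rest , shift x (h ∷ h₂ ∷ []) rest ,
                 hh₂ ∷ adj-sym G (otherNeighbour ¬xh x≢h x≢h₂ h≢h₂) ∷
                 xThenRest h≢rest x≢rest (Linked.tail linked)
    where
      xThenRest : ∀ {rest} → All (h ≢_) rest → All (x ≢_) rest → Linked (Adj G) rest →
                  Linked (Adj G) (x ∷ rest)
      xThenRest [] [] [] = [-]
      xThenRest (h≢y ∷ _) (x≢y ∷ _) linked′ = otherNeighbour ¬xh x≢h x≢y h≢y ∷ linked′
  insert {ys = _ ∷ []} _ _ [-] (s≤s ())

  arrange : ∀ xs → Unique xs → 3 ≤ length xs → ∃ λ ys → ys ↭ xs × Linked (Adj G) ys
  arrange (a ∷ b ∷ c ∷ []) ((a≢b ∷ a≢c ∷ []) ∷ (b≢c ∷ []) ∷ _) _ with adjacent? G b c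
  ... | yes bc = insert ((b≢c ∷ []) ∷ [] ∷ []) (a≢b ∷ a≢c ∷ []) (bc ∷ [-]) (s≤s (s≤s z≤n))
  ... | no ¬bc = b ∷ a ∷ c ∷ [] , ↭-swap b a ↭-refl , ba ∷ adj-sym G ca ∷ [-]
    where
      ba : Adj G b a
      ba = otherNeighbour ¬bc b≢c (≢-sym a≢b) (≢-sym a≢c)
      ca : Adj G c a
      ca = otherNeighbour (¬bc ∘ adj-sym G) (≢-sym b≢c) (≢-sym a≢c) (≢-sym a≢b)
  arrange (a ∷ xs@(_ ∷ _ ∷ _ ∷ _)) (a≢xs ∷ unique) _ =
    let ys , ys↭xs , linked = arrange xs unique (s≤s (s≤s (s≤s z≤n)))
        xs↭ys = ↭-sym ys↭xs
        zs , zs↭ays , linked′ = insert (unique-↭ xs↭ys unique) (All-resp-↭ xs↭ys a≢xs) linked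
                                       (subst (2 ≤_) (sym (↭-length ys↭xs)) (s≤s (s≤s z≤n)))
    in zs , ↭-trans zs↭ays (↭-prep a ys↭xs) , linked′
  arrange (_ ∷ []) _ (s≤s ())
  arrange (_ ∷ _ ∷ []) _ (s≤s (s≤s ()))

  pathOutside : ∀ {k} S → 3 ≤ k → k + ∣ S ∣ ≤ n →
                ∃₂ λ m (P : Path G m) → k ≤ m × (∀ i → vtx P i ∉ S)
  pathOutside {k} S 3≤k bound =
    let xs , unique , outsideS , length-xs = distinctOutside S k bound
        ys , ys↭xs , linked = arrange xs unique (subst (3 ≤_) (sym length-xs) 3≤k)
    in length ys , listPath G ys (unique-↭ (↭-sym ys↭xs) unique) linked ,
       ≤-reflexive (sym (trans (↭-length ys↭xs) length-xs)) ,
       λ i → All.lookup (All-resp-↭ (↭-sym ys↭xs) outsideS) (∈-lookup i)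

  -- Lower bound ψ_j ≥ n - t for j ≤ t + 1, t ≥ 2: otherwise t + 1 vertices lie
  -- outside the cover and carry an uncovered path.
  coverLowerBound : ∀ {t j S} → 2 ≤ t → j ≤ suc t → IsKPathVertexCover G j S → n ∸ t ≤ ∣ S ∣
  coverLowerBound {t} {j} {S} 2≤t j≤1+t cover with n ≤? t + ∣ S ∣
  ... | yes n≤t+S = m≤n+o⇒m∸n≤o n t n≤t+S
  ... | no n≰t+S with pathOutside S (s≤s 2≤t) (≰⇒> n≰t+S)
  ... | _ , P , 1+t≤m , avoidsS with cover (prefixPath G P (≤-trans j≤1+t 1+t≤m))
  ... | i , vᵢ∈S = contradiction vᵢ∈S (avoidsS _)

  -- With at least three vertices, any two vertices are at distance at most two:
  -- non-adjacent u, v are both adjacent to any third vertex.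
  connected : 3 ≤ n → Connected G
  connected 3≤n u v with u ≟ v
  ... | yes refl = ε
  ... | no u≢v with adjacent? G u v
  ... | yes uv = uv ◅ ε
  ... | no ¬uv = let w , u≢w , v≢w = thirdVertex 3≤n u v in
      otherNeighbour ¬uv u≢v u≢w v≢w
      ◅ adj-sym G (otherNeighbour (¬uv ∘ adj-sym G) (≢-sym u≢v) v≢w u≢w)
      ◅ ε

  pathSequence : FirstPairIndependent G → (i : Fin n) → IsPsi G (suc (toℕ i)) (n ∸ coverThreshold i)
  pathSequence _ zero =
    (atLeast n 0 , atLeast-cover G (s≤s z≤n) , ∣atLeast∣ n 0) , everyVertexCover G
  pathSequence independent (suc zero) =
    (atLeast n 2 , firstPair-cover G independent , ∣atLeast∣ n 2) ,
    λ _ → coverLowerBound ≤-refl (s≤s (s≤s z≤n))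
  pathSequence _ i@(suc (suc _)) =
    (atLeast n (toℕ i) , atLeast-cover G (n<1+n (toℕ i)) , ∣atLeast∣ n (toℕ i)) ,
    λ _ → coverLowerBound (s≤s (s≤s z≤n)) ≤-refl

partner : ℕ → ℕ
partner 0 = 1
partner 1 = 0
partner (suc (suc a)) = suc (suc (partner a))

partner-≢ : ∀ a → partner a ≢ a
partner-≢ 0 ()
partner-≢ 1 ()
partner-≢ (suc (suc a)) e = partner-≢ a (ℕ-suc-injective (ℕ-suc-injective e))

matched : ℕ → ℕ → ℕ → Bool
matched zero _ _ = false
matched (suc m) 0 1 = true
matched (suc m) 1 0 = true
matched (suc m) (suc (suc a)) (suc (suc b)) = matched m a b
matched (suc m) _ _ = false

matched-sym : ∀ m a b → matched m a b ≡ matched m b a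
matched-sym zero a b = refl
matched-sym (suc m) 0 0 = refl
matched-sym (suc m) 0 1 = refl
matched-sym (suc m) 0 (suc (suc b)) = refl
matched-sym (suc m) 1 0 = refl
matched-sym (suc m) 1 1 = refl
matched-sym (suc m) 1 (suc (suc b)) = refl
matched-sym (suc m) (suc (suc a)) 0 = refl
matched-sym (suc m) (suc (suc a)) 1 = refl
matched-sym (suc m) (suc (suc a)) (suc (suc b)) = matched-sym m a b

matched⇒partner : ∀ m a b → matched m a b ≡ true → b ≡ partner a
matched⇒partner (suc m) 0 1 _ = refl
matched⇒partner (suc m) 1 0 _ = refl
matched⇒partner (suc m) (suc (suc a)) (suc (suc b)) e = cong (2 +_) (matched⇒partner m a b e)
matched⇒partner zero _ _ ()
matched⇒partner (suc m) 0 0 ()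
matched⇒partner (suc m) 0 (suc (suc _)) ()
matched⇒partner (suc m) 1 1 ()
matched⇒partner (suc m) 1 (suc (suc _)) ()
matched⇒partner (suc m) (suc (suc _)) 0 ()
matched⇒partner (suc m) (suc (suc _)) 1 ()

matched⇒bound : ∀ m a b → matched m a b ≡ true → a < 2 * m
matched⇒bound (suc m) 0 1 _ = s≤s z≤n
matched⇒bound (suc m) 1 0 _ = subst (1 <_) (sym (*-suc 2 m)) (s≤s (s≤s z≤n))
matched⇒bound (suc m) (suc (suc a)) (suc (suc b)) e =
  subst (suc (suc a) <_) (sym (*-suc 2 m)) (s≤s (s≤s (matched⇒bound m a b e)))
matched⇒bound zero _ _ ()
matched⇒bound (suc m) 0 0 ()
matched⇒bound (suc m) 0 (suc (suc _)) ()
matched⇒bound (suc m) 1 1 ()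
matched⇒bound (suc m) 1 (suc (suc _)) ()
matched⇒bound (suc m) (suc (suc _)) 0 ()
matched⇒bound (suc m) (suc (suc _)) 1 ()

bound⇒matched : ∀ m a → a < 2 * m → matched m a (partner a) ≡ true
bound⇒matched (suc m) 0 _ = refl
bound⇒matched (suc m) 1 _ = refl
bound⇒matched (suc m) (suc (suc a)) a<2m+2 with subst (suc (suc a) <_) (*-suc 2 m) a<2m+2
... | s≤s (s≤s a<2m) = bound⇒matched m a a<2m

matched-first : ∀ m a b → a < 2 → b < 2 → a ≢ b → matched (suc m) a b ≡ true
matched-first m 0 0 _ _ a≢b = contradiction refl a≢b
matched-first m 0 1 _ _ _ = refl
matched-first m 1 0 _ _ _ = refl
matched-first m 1 1 _ _ a≢b = contradiction refl a≢b
matched-first m (suc (suc _)) _ (s≤s (s≤s ())) _ _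
matched-first m 0 (suc (suc _)) _ (s≤s (s≤s ())) _
matched-first m 1 (suc (suc _)) _ (s≤s (s≤s ())) _

does-≟-sym : ∀ {n} (u v : Fin n) → does (u ≟ v) ≡ does (v ≟ u)
does-≟-sym u v with u ≟ v | v ≟ u
... | yes _ | yes _ = refl
... | no _ | no _ = refl
... | yes u≡v | no v≢u = contradiction (sym u≡v) v≢u
... | no u≢v | yes v≡u = contradiction (sym v≡u) u≢v

coMatching : (n m : ℕ) → Graph n
coMatching n m = record
  { adj = λ u v → not (does (u ≟ v)) ∧ not (matched m (toℕ u) (toℕ v))
  ; sym = λ u v → cong₂ (λ d e → not d ∧ not e) (does-≟-sym u v) (matched-sym m (toℕ u) (toℕ v))
  ; irefl = λ v → cong (λ d → not d ∧ not (matched m (toℕ v) (toℕ v))) (dec-true (v ≟ v) refl)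
  }

HasNonNeighbour : ∀ {n} → Graph n → Fin n → Set
HasNonNeighbour G v = ∃ λ w → v ≢ w × adj G v w ≡ false

from-injective : ∀ {A B : Set} (f : A ↔ B) → Injective _≡_ _≡_ (Inverse.from f)
from-injective f = Injection.injective (↔⇒↣ (↔-sym f))

iso-nonNeighbour : ∀ {n} {G H : Graph n} (iso : Isomorphic G H) →
                   ∀ {v} → HasNonNeighbour H v → HasNonNeighbour G (Inverse.from (proj₁ iso) v)
iso-nonNeighbour {H = H} (f , preserves) {v} (w , v≢w , vw) =
  from w , v≢w ∘ from-injective f ,
  trans (preserves (from v) (from w))
        (trans (cong₂ (adj H) (strictlyInverseˡ v) (strictlyInverseˡ w)) vw)
  where open Inverse f using (from; strictlyInverseˡ)

module _ {n m : ℕ} where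

  coMatching-adj : ∀ {u v : Fin n} → u ≢ v →
                   adj (coMatching n m) u v ≡ not (matched m (toℕ u) (toℕ v))
  coMatching-adj {u} {v} u≢v =
    cong (λ d → not d ∧ not (matched m (toℕ u) (toℕ v))) (dec-false (u ≟ v) u≢v)

  adjacentUnlessMatched : ∀ {u v : Fin n} → u ≢ v →
                          Adj (coMatching n m) u v ⊎ matched m (toℕ u) (toℕ v) ≡ true
  adjacentUnlessMatched {u} {v} u≢v with matched m (toℕ u) (toℕ v)
  ... | false = inj₁ (cong (λ d → not d ∧ true) (dec-false (u ≟ v) u≢v))
  ... | true = inj₂ refl

  -- A vertex is matched to at most one other vertex.
  coMatching-nearlyComplete : NearlyComplete (coMatching n m)
  coMatching-nearlyComplete u≢v u≢w v≢w
    with adjacentUnlessMatched u≢v | adjacentUnlessMatched u≢w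
  ... | inj₁ uv | _ = inj₁ uv
  ... | inj₂ _ | inj₁ uw = inj₂ uw
  ... | inj₂ uv | inj₂ uw =
    contradiction (toℕ-injective (trans (matched⇒partner m _ _ uv) (sym (matched⇒partner m _ _ uw))))
                  v≢w

  nonNeighbour⇒bound : ∀ {v : Fin n} → HasNonNeighbour (coMatching n m) v → toℕ v < 2 * m
  nonNeighbour⇒bound (w , v≢w , vw) =
    matched⇒bound m _ _ (not-injective (trans (sym (coMatching-adj v≢w)) vw))

  bound⇒nonNeighbour : 2 * m ≤ n → ∀ {v : Fin n} → toℕ v < 2 * m →
                       HasNonNeighbour (coMatching n m) v
  bound⇒nonNeighbour 2m≤n {v} v<2m = w , v≢w , trans (coMatching-adj v≢w) (cong not vw-matched)
    where
      v-matched : matched m (toℕ v) (partner (toℕ v)) ≡ true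
      v-matched = bound⇒matched m (toℕ v) v<2m
      partner<n : partner (toℕ v) < n
      partner<n = ≤-trans (matched⇒bound m _ _ (trans (matched-sym m _ _) v-matched)) 2m≤n
      w : Fin n
      w = fromℕ< partner<n
      v≢w : v ≢ w
      v≢w v≡w = partner-≢ (toℕ v) (sym (trans (cong toℕ v≡w) (toℕ-fromℕ< partner<n)))
      vw-matched : matched m (toℕ v) (toℕ w) ≡ true
      vw-matched =
        subst (λ b → matched m (toℕ v) b ≡ true) (sym (toℕ-fromℕ< partner<n)) v-matched

  coMatching-firstPair : FirstPairIndependent (coMatching n (suc m))
  coMatching-firstPair u v u<2 v<2 uv with u ≟ v
  ... | yes refl = contradiction uv λ ()
  ... | no u≢v = contradiction (trans (sym uv) (cong not both-first)) λ ()
    where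
      both-first : matched (suc m) (toℕ u) (toℕ v) ≡ true
      both-first = matched-first m (toℕ u) (toℕ v) u<2 v<2 (u≢v ∘ toℕ-injective)

-- Removing m < m' matching edges gives non-isomorphic graphs: an isomorphism
-- would map the 2m + 1 vertices below 2m + 1, which have non-neighbours in
-- coMatching n m', injectively onto vertices below 2m.
coMatching-nonIsomorphic : ∀ {n m m′} → m < m′ → 2 * m′ ≤ n →
                           ¬ Isomorphic (coMatching n m) (coMatching n m′)
coMatching-nonIsomorphic {n} {m} {m′} m<m′ 2m′≤n iso =
  noInjectionBelow image image-injective (n<1+n (2 * m)) image-below
  where
    2m<2m′ : 2 * m < 2 * m′
    2m<2m′ = *-monoʳ-< 2 m<m′
    embed : suc (2 * m) ≤ n
    embed = ≤-trans 2m<2m′ 2m′≤n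
    from : Fin n → Fin n
    from = Inverse.from (proj₁ iso)
    image : Fin (suc (2 * m)) → Fin n
    image i = from (inject≤ i embed)
    image-injective : Injective _≡_ _≡_ image
    image-injective e = inject≤-injective embed embed _ _ (from-injective (proj₁ iso) e)
    image-below : ∀ i → toℕ (image i) < 2 * m
    image-below i =
      nonNeighbour⇒bound {m = m}
        (iso-nonNeighbour {G = coMatching n m} {H = coMatching n m′} iso nonNeighbour-in-H)
      where
        nonNeighbour-in-H : HasNonNeighbour (coMatching n m′) (inject≤ i embed)
        nonNeighbour-in-H = bound⇒nonNeighbour {m = m′} 2m′≤n
          (subst (_< 2 * m′) (sym (toℕ-inject≤ i embed)) (<-≤-trans (toℕ<n i) 2m<2m′))

mainTheorem7 : (n : ℕ) → 4 ≤ n →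
    Σ (Graph n) λ G → Σ (Graph n) λ H →
      Connected G × Connected H × SamePathSequence G H × ¬ Isomorphic G H
mainTheorem7 n 4≤n =
  coMatching n 1 , coMatching n 2 ,
  G.connected 3≤n , H.connected 3≤n ,
  ((λ i → n ∸ coverThreshold i) ,
   λ i → G.pathSequence coMatching-firstPair i , H.pathSequence coMatching-firstPair i) ,
  coMatching-nonIsomorphic (s≤s (s≤s z≤n)) 4≤n
  where
    module G = NearlyCompleteGraph (coMatching-nearlyComplete {n} {1})
    module H = NearlyCompleteGraph (coMatching-nearlyComplete {n} {2})
    3≤n : 3 ≤ n
    3≤n = ≤-trans (n≤1+n 3) 4≤n
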